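{- For every integer $N\ge 0$ and every even integer $n\ge 2$, $$E_{N,n}=n!\sum_{k=1}^{n}(-1)^k\binom{n+1}{k+1}\sum_{\substack{i_1,\dots,i_k\ge 0\\ i_1+\cdots+i_k=n/2}}\frac{\bigl((2N)!\bigr)^k}{(2N+2i_1)!\cdots(2N+2i_k)!}.$$
   Context: For an integer $N\ge 0$, the hypergeometric Euler numbers $E_{N,n}$ ($n\ge 0$) are defined by $\dfrac{1}{F_N(t)}=\sum_{n=0}^\infty E_{N,n}\frac{t^n}{n!}$, where $F_N(t)={}_1F_2\bigl(1;N+1,\tfrac{2N+1}{2};\tfrac{t^2}{4}\bigr)=\sum_{m\ge 0}\frac{(2N)!}{(2N+2m)!}t^{2m}$. The inner sum runs over ordered $k$-tuples of nonnegative integers. -}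

module Defs where

open import Data.Nat as ℕ using (ℕ; zero; suc; _∸_)
open import Data.Integer using (+_)
open import Data.Nat.Properties using (m*n≢0)
open import Data.Rational using (ℚ; _+_; _*_; -_; _/_; 0ℚ; 1ℚ)
open import Data.List using (List; []; _∷_; map; concatMap; zipWith; upTo; foldr)

fact : ℕ → ℕ
fact zero = 1
fact (suc n) = suc n ℕ.* fact n

fact-nonZero : ∀ n → ℕ.NonZero (fact n)
fact-nonZero zero = _
fact-nonZero (suc n) = m*n≢0 (suc n) (fact n) {{_}} {{fact-nonZero n}}

ℕ→ℚ : ℕ → ℚ
ℕ→ℚ n = (+ n) / 1

sumℚ : List ℚ → ℚ
sumℚ = foldr _+_ 0ℚ

sign : ℕ → ℚ
sign zero = 1ℚ
sign (suc k) = - sign k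

-- a_m = (2N)! / (2N+2m)!, the coefficient of t^{2m} in F_N(t)
aCoef : ℕ → ℕ → ℚ
aCoef N m = ((+ fact (2 ℕ.* N)) / fact (2 ℕ.* N ℕ.+ 2 ℕ.* m)) {{fact-nonZero (2 ℕ.* N ℕ.+ 2 ℕ.* m)}}

-- even-indexed series: evenSeries a j = a (j/2) if j even, 0 if j odd
evenSeries : (ℕ → ℚ) → ℕ → ℚ
evenSeries a zero = a zero
evenSeries a (suc zero) = 0ℚ
evenSeries a (suc (suc j)) = evenSeries (λ m → a (suc m)) j

-- fCoef N j = coefficient of t^j in F_N(t) = Σ_m (2N)!/(2N+2m)! t^{2m}
fCoef : ℕ → ℕ → ℚ
fCoef N = evenSeries (aCoef N)

-- Coefficients of the reciprocal power series 1/F_N(t) = Σ b_n t^n.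
-- Since F_N has constant term 1, these are determined by F_N · (1/F_N) = 1:
--   b_0 = 1,  b_n = - Σ_{j=1}^{n} f_j b_{n-j}  (n ≥ 1).
-- recipRev N n = [b_n, b_{n-1}, ..., b_0].
recipRev : ℕ → ℕ → List ℚ
recipRev N zero = 1ℚ ∷ []
recipRev N (suc n) =
  (- sumℚ (zipWith _*_ (map (λ j → fCoef N (suc j)) (upTo (suc n))) (recipRev N n)))
  ∷ recipRev N n

headℚ : List ℚ → ℚ
headℚ [] = 0ℚ
headℚ (x ∷ _) = x

recipCoef : ℕ → ℕ → ℚ
recipCoef N n = headℚ (recipRev N n)

-- hypergeometric Euler number E_{N,n} = n! · [t^n] (1/F_N(t))
E : ℕ → ℕ → ℚ
E N n = ℕ→ℚ (fact n) * recipCoef N n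

-- all ordered k-tuples (as lists of length k) of naturals summing to s
tuples : ℕ → ℕ → List (List ℕ)
tuples zero zero = [] ∷ []
tuples zero (suc s) = []
tuples (suc k) s = concatMap (λ i → map (i ∷_) (tuples k (s ∸ i))) (upTo (suc s))

prodFact : ℕ → List ℕ → ℕ
prodFact N [] = 1
prodFact N (i ∷ is) = fact (2 ℕ.* N ℕ.+ 2 ℕ.* i) ℕ.* prodFact N is

prodFact-nonZero : ∀ N is → ℕ.NonZero (prodFact N is)
prodFact-nonZero N [] = _
prodFact-nonZero N (i ∷ is) =
  m*n≢0 (fact (2 ℕ.* N ℕ.+ 2 ℕ.* i)) (prodFact N is) {{fact-nonZero (2 ℕ.* N ℕ.+ 2 ℕ.* i)}} {{prodFact-nonZero N is}}

term : ℕ → ℕ → List ℕ → ℚ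
term N k is = ((+ (fact (2 ℕ.* N) ℕ.^ k)) / prodFact N is) {{prodFact-nonZero N is}}

innerSum : ℕ → ℕ → ℕ → ℚ
innerSum N k s = sumℚ (map (term N k) (tuples k s))

{-# OPTIONS --safe #-}
-- Let F be the power series with coefficients f and f 0 = 1. The truncated binomial sum
-- T_M = Σ_{k ≤ M} (-1)^k C(M+1, k+1) F^k equals (1 - (1 - F)^{M+1}) / F, and since 1 - F has no
-- constant term it agrees with 1/F in all degrees ≤ M; concretely T_{M+1} = 1 - (F - 1) T_M by
-- Pascal's rule, which is the recursion defining the coefficients of 1/F. Take M = n: the k = 0
-- term contributes nothing in degree n ≥ 2, and as F_N is even with t^{2m}-coefficient
-- (2N)!/(2N+2m)!, the t^n-coefficient of F_N^k is the sum over k-tuples with i₁ + ⋯ + iₖ = n/2.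
module Submission where

open import Defs
open import Data.Nat as ℕ using (ℕ; zero; suc; _≤_; _<_; _+_; _∸_; z≤n; s≤s; NonZero)
open import Data.Nat.Divisibility using (_∣_)
open import Data.Nat.DivMod using (_/_)
open import Data.Nat.Combinatorics using (_C_)
open import Data.Rational using (ℚ; _*_)
open import Data.List using (map; upTo)
open import Relation.Binary.PropositionalEquality using (_≡_)

open import Algebra.Bundles using (CommutativeRing)
open import Data.Fin using (toℕ)
open import Data.Fin.Properties using (toℕ-inject₁; toℕ-fromℕ)
open import Data.Integer as ℤ using (+_)
import Data.Integer.Properties as ℤ
open import Data.List using (List; []; _∷_; _++_; zipWith; concatMap; applyUpTo)
open import Data.List.Properties using (map-∘; map-cong; map-++)
open import Data.Nat.Combinatorics using (nCk+nC[k+1]≡[n+1]C[k+1]; k>n⇒nCk≡0)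
open import Data.Nat.DivMod using (m*n/n≡m)
open import Data.Nat.Divisibility using (divides)
import Data.Nat.Properties as ℕ
open import Data.Rational using (0ℚ; 1ℚ; _-_; -_; toℚᵘ; fromℚᵘ) renaming (_+_ to _⊕_; _/_ to _÷_)
open import Data.Rational.Properties
open import Data.Rational.Solver using (module +-*-Solver)
import Data.Rational.Unnormalised as ℚᵘ
import Data.Rational.Unnormalised.Properties as ℚᵘ
open import Function using (_∘_)
open import Relation.Binary.PropositionalEquality using (refl; sym; trans; cong; cong₂; module ≡-Reasoning)

open import Algebra.Properties.Semiring.Sum (CommutativeRing.semiring +-*-commutativeRing)
  using (sum; sum-cong-≗; ∑-distrib-+; ∑-comm; sum-init-last; sum-replicate-zero; *-distribˡ-sum)
open +-*-Solver using (solve; _:+_; _:*_; :-_; _:-_; _:=_)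
open ≡-Reasoning

fromℚᵘ-homo-+ : ∀ p q → fromℚᵘ (p ℚᵘ.+ q) ≡ fromℚᵘ p ⊕ fromℚᵘ q
fromℚᵘ-homo-+ p q = toℚᵘ-injective (ℚᵘ.≃-trans (toℚᵘ-fromℚᵘ (p ℚᵘ.+ q))
  (ℚᵘ.≃-trans (ℚᵘ.+-cong (ℚᵘ.≃-sym (toℚᵘ-fromℚᵘ p)) (ℚᵘ.≃-sym (toℚᵘ-fromℚᵘ q)))
    (ℚᵘ.≃-sym (toℚᵘ-homo-+ (fromℚᵘ p) (fromℚᵘ q)))))

fromℚᵘ-homo-* : ∀ p q → fromℚᵘ (p ℚᵘ.* q) ≡ fromℚᵘ p * fromℚᵘ q
fromℚᵘ-homo-* p q = toℚᵘ-injective (ℚᵘ.≃-trans (toℚᵘ-fromℚᵘ (p ℚᵘ.* q))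
  (ℚᵘ.≃-trans (ℚᵘ.*-cong (ℚᵘ.≃-sym (toℚᵘ-fromℚᵘ p)) (ℚᵘ.≃-sym (toℚᵘ-fromℚᵘ q)))
    (ℚᵘ.≃-sym (toℚᵘ-homo-* (fromℚᵘ p) (fromℚᵘ q)))))

ℕ→ℚ-homo-+ : ∀ m n → ℕ→ℚ (m + n) ≡ ℕ→ℚ m ⊕ ℕ→ℚ n
ℕ→ℚ-homo-+ m n = begin
  fromℚᵘ (ℚᵘ.mkℚᵘ (+ (m + n)) 0)
    ≡⟨ cong (λ z → fromℚᵘ (ℚᵘ.mkℚᵘ z 0)) (trans (ℤ.pos-+ m n)
         (sym (cong₂ ℤ._+_ (ℤ.*-identityʳ (+ m)) (ℤ.*-identityʳ (+ n))))) ⟩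
  fromℚᵘ (ℚᵘ.mkℚᵘ (+ m) 0 ℚᵘ.+ ℚᵘ.mkℚᵘ (+ n) 0)
    ≡⟨ fromℚᵘ-homo-+ (ℚᵘ.mkℚᵘ (+ m) 0) (ℚᵘ.mkℚᵘ (+ n) 0) ⟩
  ℕ→ℚ m ⊕ ℕ→ℚ n ∎

/-homo-* : ∀ m n p q .{{_ : NonZero p}} .{{_ : NonZero q}} →
  ((+ (m ℕ.* n)) ÷ (p ℕ.* q)) {{ℕ.m*n≢0 p q}} ≡ ((+ m) ÷ p) * ((+ n) ÷ q)
/-homo-* m n (suc p) (suc q) =
  trans (cong (λ z → fromℚᵘ (ℚᵘ.mkℚᵘ z (q ℕ.+ p ℕ.* suc q))) (ℤ.pos-* m n))
        (fromℚᵘ-homo-* (ℚᵘ.mkℚᵘ (+ m) p) (ℚᵘ.mkℚᵘ (+ n) q))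

n/n≡1 : ∀ n .{{_ : NonZero n}} → (+ n) ÷ n ≡ 1ℚ
n/n≡1 (suc n) = fromℚᵘ-cong {ℚᵘ.mkℚᵘ (+ suc n) n} {ℚᵘ.1ℚᵘ}
  (ℚᵘ.*≡* (trans (ℤ.*-identityʳ (+ suc n)) (sym (ℤ.*-identityˡ (+ suc n)))))

∑ℕ : ℕ → (ℕ → ℚ) → ℚ
∑ℕ n f = sum {n} (f ∘ toℕ)

∑ℕ-cong : ∀ n {f g : ℕ → ℚ} → (∀ i → f i ≡ g i) → ∑ℕ n f ≡ ∑ℕ n g
∑ℕ-cong n f≗g = sum-cong-≗ {n} (f≗g ∘ toℕ)

∑ℕ-last : ∀ n (f : ℕ → ℚ) → ∑ℕ (suc n) f ≡ ∑ℕ n f ⊕ f n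
∑ℕ-last n f = trans (sum-init-last {n} (f ∘ toℕ))
  (cong₂ _⊕_ (sum-cong-≗ {n} (cong f ∘ toℕ-inject₁)) (cong f (toℕ-fromℕ n)))

∑ℕ-distrib-+ : ∀ n (f g : ℕ → ℚ) → ∑ℕ n (λ i → f i ⊕ g i) ≡ ∑ℕ n f ⊕ ∑ℕ n g
∑ℕ-distrib-+ n f g = ∑-distrib-+ {n} (f ∘ toℕ) (g ∘ toℕ)

neg-∑ℕ : ∀ n (f : ℕ → ℚ) → - ∑ℕ n f ≡ ∑ℕ n (λ i → - f i)
neg-∑ℕ zero    f = refl
neg-∑ℕ (suc n) f = trans (neg-distrib-+ (f 0) (∑ℕ n (f ∘ suc))) (cong (- f 0 ⊕_) (neg-∑ℕ n (f ∘ suc)))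

δ : ℕ → ℚ
δ zero    = 1ℚ
δ (suc _) = 0ℚ

infixl 7 _⋆_ _⋆⁺_
infixr 8 _^⋆_

_⋆_ : (ℕ → ℚ) → (ℕ → ℚ) → ℕ → ℚ
(x ⋆ y) n = ∑ℕ (suc n) λ j → x j * y (n ∸ j)

_^⋆_ : (ℕ → ℚ) → ℕ → ℕ → ℚ
x ^⋆ zero  = δ
x ^⋆ suc k = x ⋆ x ^⋆ k

⋆-congʳ : ∀ x {y z : ℕ → ℚ} → (∀ m → y m ≡ z m) → ∀ n → (x ⋆ y) n ≡ (x ⋆ z) n
⋆-congʳ x y≗z n = ∑ℕ-cong (suc n) (λ j → cong (x j *_) (y≗z (n ∸ j)))

_⋆⁺_ : (ℕ → ℚ) → (ℕ → ℚ) → ℕ → ℚ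
(x ⋆⁺ y) zero    = 0ℚ
(x ⋆⁺ y) (suc n) = ∑ℕ (suc n) λ j → x (suc j) * y (n ∸ j)

⋆-split : ∀ x y n → (x ⋆ y) n ≡ x 0 * y n ⊕ (x ⋆⁺ y) n
⋆-split x y zero    = refl
⋆-split x y (suc n) = refl

⋆⁺-cong-below : ∀ x {y z : ℕ → ℚ} n → (∀ m → m < n → y m ≡ z m) → (x ⋆⁺ y) n ≡ (x ⋆⁺ z) n
⋆⁺-cong-below x zero    y≗z = refl
⋆⁺-cong-below x (suc n) y≗z =
  ∑ℕ-cong (suc n) (λ j → cong (x (suc j) *_) (y≗z (n ∸ j) (s≤s (ℕ.m∸n≤m n j))))

⋆⁺-distrib-∑ℕ : ∀ x K (c : ℕ → ℚ) (y : ℕ → ℕ → ℚ) n →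
  (x ⋆⁺ (λ m → ∑ℕ K λ k → c k * y k m)) n ≡ ∑ℕ K (λ k → c k * (x ⋆⁺ y k) n)
⋆⁺-distrib-∑ℕ x K c y zero = begin
  0ℚ                      ≡⟨ sum-replicate-zero K ⟨
  ∑ℕ K (λ _ → 0ℚ)         ≡⟨ ∑ℕ-cong K (λ k → *-zeroʳ (c k)) ⟨
  ∑ℕ K (λ k → c k * 0ℚ)   ∎
⋆⁺-distrib-∑ℕ x K c y (suc n) = begin
  ∑ℕ (suc n) (λ j → x (suc j) * ∑ℕ K λ k → c k * y k (n ∸ j))
    ≡⟨ ∑ℕ-cong (suc n) (λ j → trans (*-distribˡ-sum {K} (x (suc j)) (λ k → c (toℕ k) * y (toℕ k) (n ∸ j)))
         (∑ℕ-cong K (λ k → *-exchange (x (suc j)) (c k) (y k (n ∸ j))))) ⟩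
  ∑ℕ (suc n) (λ j → ∑ℕ K λ k → c k * (x (suc j) * y k (n ∸ j)))
    ≡⟨ ∑-comm {suc n} {K} (λ j k → c (toℕ k) * (x (suc (toℕ j)) * y (toℕ k) (n ∸ toℕ j))) ⟩
  ∑ℕ K (λ k → ∑ℕ (suc n) λ j → c k * (x (suc j) * y k (n ∸ j)))
    ≡⟨ ∑ℕ-cong K (λ k → sym (*-distribˡ-sum {suc n} (c k) (λ j → x (suc (toℕ j)) * y k (n ∸ toℕ j)))) ⟩
  ∑ℕ K (λ k → c k * (x ⋆⁺ y k) (suc n)) ∎
  where
  *-exchange : ∀ p q r → p * (q * r) ≡ q * (p * r)
  *-exchange = solve 3 (λ p q r → p :* (q :* r) := q :* (p :* r)) refl

evenSeries-zero : ∀ n → evenSeries (λ _ → 0ℚ) n ≡ 0ℚ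
evenSeries-zero zero          = refl
evenSeries-zero (suc zero)    = refl
evenSeries-zero (suc (suc n)) = evenSeries-zero n

evenSeries-δ : ∀ n → evenSeries δ n ≡ δ n
evenSeries-δ zero          = refl
evenSeries-δ (suc zero)    = refl
evenSeries-δ (suc (suc n)) = evenSeries-zero n

evenSeries-*-+ : ∀ c x y n → evenSeries (λ m → c * x m ⊕ y m) n ≡ c * evenSeries x n ⊕ evenSeries y n
evenSeries-*-+ c x y zero          = refl
evenSeries-*-+ c x y (suc zero)    = sym (trans (+-identityʳ (c * 0ℚ)) (*-zeroʳ c))
evenSeries-*-+ c x y (suc (suc n)) = evenSeries-*-+ c (x ∘ suc) (y ∘ suc) n

evenSeries-double : ∀ x q → evenSeries x (q ℕ.* 2) ≡ x q
evenSeries-double x zero    = refl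
evenSeries-double x (suc q) = evenSeries-double (x ∘ suc) q

-- In degree n + 2 the odd-indexed terms vanish and the rest is the degree-n product with x shifted.
evenSeries-⋆ : ∀ x y n → (evenSeries x ⋆ evenSeries y) n ≡ evenSeries (x ⋆ y) n
evenSeries-⋆ x y zero          = refl
evenSeries-⋆ x y (suc zero)    = begin
  x 0 * 0ℚ ⊕ (0ℚ * y 0 ⊕ 0ℚ) ≡⟨ cong₂ _⊕_ (*-zeroʳ (x 0)) (trans (+-identityʳ _) (*-zeroˡ (y 0))) ⟩
  0ℚ ⊕ 0ℚ                   ≡⟨ +-identityˡ 0ℚ ⟩
  0ℚ                        ∎
evenSeries-⋆ x y (suc (suc n)) = begin
  x 0 * evenSeries (y ∘ suc) n ⊕ (0ℚ * evenSeries y (suc n) ⊕ (evenSeries (x ∘ suc) ⋆ evenSeries y) n)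
    ≡⟨ cong (x 0 * evenSeries (y ∘ suc) n ⊕_)
         (trans (cong (_⊕ (evenSeries (x ∘ suc) ⋆ evenSeries y) n) (*-zeroˡ (evenSeries y (suc n))))
                (+-identityˡ _)) ⟩
  x 0 * evenSeries (y ∘ suc) n ⊕ (evenSeries (x ∘ suc) ⋆ evenSeries y) n
    ≡⟨ cong (x 0 * evenSeries (y ∘ suc) n ⊕_) (evenSeries-⋆ (x ∘ suc) y n) ⟩
  x 0 * evenSeries (y ∘ suc) n ⊕ evenSeries ((x ∘ suc) ⋆ y) n
    ≡⟨ evenSeries-*-+ (x 0) (y ∘ suc) ((x ∘ suc) ⋆ y) n ⟨
  evenSeries (x ⋆ y) (suc (suc n)) ∎

evenSeries-^⋆ : ∀ x k n → (evenSeries x ^⋆ k) n ≡ evenSeries (x ^⋆ k) n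
evenSeries-^⋆ x zero    n = sym (evenSeries-δ n)
evenSeries-^⋆ x (suc k) n = begin
  (evenSeries x ⋆ evenSeries x ^⋆ k) n              ≡⟨ ⋆-congʳ (evenSeries x) (evenSeries-^⋆ x k) n ⟩
  (evenSeries x ⋆ evenSeries (x ^⋆ k)) n           ≡⟨ evenSeries-⋆ x (x ^⋆ k) n ⟩
  evenSeries (x ^⋆ suc k) n                        ∎

binomialSum : (ℕ → ℚ) → ℕ → ℕ → ℚ
binomialSum f M n = ∑ℕ (suc M) λ k → sign k * ℕ→ℚ (suc M C suc k) * (f ^⋆ k) n

binomialSum-suc : ∀ f → f 0 ≡ 1ℚ → ∀ M n → binomialSum f (suc M) n ≡ δ n - (f ⋆⁺ binomialSum f M) n
binomialSum-suc f f₀≡1 M n = begin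
  binomialSum f (suc M) n
    ≡⟨ ∑ℕ-cong (suc (suc M)) pascal ⟩
  ∑ℕ (suc (suc M)) (λ k → sign k * ℕ→ℚ (suc M C k) * P k ⊕ c k * P k)
    ≡⟨ ∑ℕ-distrib-+ (suc (suc M)) (λ k → sign k * ℕ→ℚ (suc M C k) * P k) (λ k → c k * P k) ⟩
  ∑ℕ (suc (suc M)) (λ k → sign k * ℕ→ℚ (suc M C k) * P k) ⊕ ∑ℕ (suc (suc M)) (λ k → c k * P k)
    ≡⟨ cong₂ _⊕_ lower upper ⟩
  (δ n ⊕ (- binomialSum f M n ⊕ - (f ⋆⁺ binomialSum f M) n)) ⊕ binomialSum f M n
    ≡⟨ solve 3 (λ d t e → (d :+ ((:- t) :+ (:- e))) :+ t := d :- e) refl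
         (δ n) (binomialSum f M n) ((f ⋆⁺ binomialSum f M) n) ⟩
  δ n - (f ⋆⁺ binomialSum f M) n ∎
  where
  P : ℕ → ℚ
  P k = (f ^⋆ k) n

  c : ℕ → ℚ
  c k = sign k * ℕ→ℚ (suc M C suc k)

  pascal : ∀ k → sign k * ℕ→ℚ (suc (suc M) C suc k) * P k ≡ sign k * ℕ→ℚ (suc M C k) * P k ⊕ c k * P k
  pascal k = begin
    sign k * ℕ→ℚ (suc (suc M) C suc k) * P k
      ≡⟨ cong (λ m → sign k * ℕ→ℚ m * P k) (nCk+nC[k+1]≡[n+1]C[k+1] (suc M) k) ⟨
    sign k * ℕ→ℚ (suc M C k + suc M C suc k) * P k
      ≡⟨ cong (λ q → sign k * q * P k) (ℕ→ℚ-homo-+ (suc M C k) (suc M C suc k)) ⟩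
    sign k * (ℕ→ℚ (suc M C k) ⊕ ℕ→ℚ (suc M C suc k)) * P k
      ≡⟨ solve 4 (λ s u v p → s :* (u :+ v) :* p := s :* u :* p :+ s :* v :* p) refl
           (sign k) (ℕ→ℚ (suc M C k)) (ℕ→ℚ (suc M C suc k)) (P k) ⟩
    sign k * ℕ→ℚ (suc M C k) * P k ⊕ c k * P k ∎

  shifted : ∀ k → - sign k * ℕ→ℚ (suc M C suc k) * P (suc k) ≡ - (c k * P k) ⊕ - (c k * (f ⋆⁺ f ^⋆ k) n)
  shifted k = begin
    - sign k * ℕ→ℚ (suc M C suc k) * (f ⋆ f ^⋆ k) n
      ≡⟨ cong (- sign k * ℕ→ℚ (suc M C suc k) *_) (⋆-split f (f ^⋆ k) n) ⟩
    - sign k * ℕ→ℚ (suc M C suc k) * (f 0 * P k ⊕ (f ⋆⁺ f ^⋆ k) n)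
      ≡⟨ cong (λ a → - sign k * ℕ→ℚ (suc M C suc k) * (a ⊕ (f ⋆⁺ f ^⋆ k) n))
           (trans (cong (_* P k) f₀≡1) (*-identityˡ (P k))) ⟩
    - sign k * ℕ→ℚ (suc M C suc k) * (P k ⊕ (f ⋆⁺ f ^⋆ k) n)
      ≡⟨ solve 4 (λ s b p d → (:- s) :* b :* (p :+ d) := (:- (s :* b :* p)) :+ (:- (s :* b :* d))) refl
           (sign k) (ℕ→ℚ (suc M C suc k)) (P k) ((f ⋆⁺ f ^⋆ k) n) ⟩
    - (c k * P k) ⊕ - (c k * (f ⋆⁺ f ^⋆ k) n) ∎

  lower : ∑ℕ (suc (suc M)) (λ k → sign k * ℕ→ℚ (suc M C k) * P k)
        ≡ δ n ⊕ (- binomialSum f M n ⊕ - (f ⋆⁺ binomialSum f M) n)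
  lower = cong₂ _⊕_ (*-identityˡ (δ n)) (begin
    ∑ℕ (suc M) (λ k → - sign k * ℕ→ℚ (suc M C suc k) * P (suc k))
      ≡⟨ ∑ℕ-cong (suc M) shifted ⟩
    ∑ℕ (suc M) (λ k → - (c k * P k) ⊕ - (c k * (f ⋆⁺ f ^⋆ k) n))
      ≡⟨ ∑ℕ-distrib-+ (suc M) (λ k → - (c k * P k)) (λ k → - (c k * (f ⋆⁺ f ^⋆ k) n)) ⟩
    ∑ℕ (suc M) (λ k → - (c k * P k)) ⊕ ∑ℕ (suc M) (λ k → - (c k * (f ⋆⁺ f ^⋆ k) n))
      ≡⟨ cong₂ _⊕_ (neg-∑ℕ (suc M) (λ k → c k * P k)) (neg-∑ℕ (suc M) (λ k → c k * (f ⋆⁺ f ^⋆ k) n)) ⟨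
    - binomialSum f M n ⊕ - ∑ℕ (suc M) (λ k → c k * (f ⋆⁺ f ^⋆ k) n)
      ≡⟨ cong (λ q → - binomialSum f M n ⊕ - q) (⋆⁺-distrib-∑ℕ f (suc M) c (f ^⋆_) n) ⟨
    - binomialSum f M n ⊕ - (f ⋆⁺ binomialSum f M) n ∎)

  upper : ∑ℕ (suc (suc M)) (λ k → c k * P k) ≡ binomialSum f M n
  upper = begin
    ∑ℕ (suc (suc M)) (λ k → c k * P k)  ≡⟨ ∑ℕ-last (suc M) (λ k → c k * P k) ⟩
    binomialSum f M n ⊕ c (suc M) * P (suc M)
      ≡⟨ cong (λ m → binomialSum f M n ⊕ sign (suc M) * ℕ→ℚ m * P (suc M)) (k>n⇒nCk≡0 (ℕ.n<1+n (suc M))) ⟩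
    binomialSum f M n ⊕ sign (suc M) * 0ℚ * P (suc M)
      ≡⟨ cong (λ q → binomialSum f M n ⊕ q * P (suc M)) (*-zeroʳ (sign (suc M))) ⟩
    binomialSum f M n ⊕ 0ℚ * P (suc M)
      ≡⟨ cong (binomialSum f M n ⊕_) (*-zeroˡ (P (suc M))) ⟩
    binomialSum f M n ⊕ 0ℚ  ≡⟨ +-identityʳ _ ⟩
    binomialSum f M n ∎

binomialSum≡reciprocal : ∀ f → f 0 ≡ 1ℚ → ∀ b → (∀ n → b n ≡ δ n - (f ⋆⁺ b) n) →
  ∀ M n → n ≤ M → binomialSum f M n ≡ b n
binomialSum≡reciprocal f f₀≡1 b b-rec zero    zero z≤n = sym (b-rec 0)
binomialSum≡reciprocal f f₀≡1 b b-rec (suc M) n  n≤1+M = begin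
  binomialSum f (suc M) n            ≡⟨ binomialSum-suc f f₀≡1 M n ⟩
  δ n - (f ⋆⁺ binomialSum f M) n     ≡⟨ cong (λ q → δ n - q) (⋆⁺-cong-below f n (λ m m<n →
                                          binomialSum≡reciprocal f f₀≡1 b b-rec M m (ℕ.≤-pred (ℕ.≤-trans m<n n≤1+M)))) ⟩
  δ n - (f ⋆⁺ b) n                   ≡⟨ b-rec n ⟨
  b n                                ∎

sumℚ-map-applyUpTo : ∀ {A : Set} (h : A → ℚ) (g : ℕ → A) n → sumℚ (map h (applyUpTo g n)) ≡ ∑ℕ n (h ∘ g)
sumℚ-map-applyUpTo h g zero    = refl
sumℚ-map-applyUpTo h g (suc n) = cong (h (g 0) ⊕_) (sumℚ-map-applyUpTo h (g ∘ suc) n)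

sumℚ-zipWith-* : ∀ {A : Set} (u : A → ℚ) (g : ℕ → A) (v : ℕ → ℚ) n →
  sumℚ (zipWith _*_ (map u (applyUpTo g n)) (applyUpTo v n)) ≡ ∑ℕ n (λ j → u (g j) * v j)
sumℚ-zipWith-* u g v zero    = refl
sumℚ-zipWith-* u g v (suc n) = cong (u (g 0) * v 0 ⊕_) (sumℚ-zipWith-* u (g ∘ suc) (v ∘ suc) n)

sumℚ-++ : ∀ xs ys → sumℚ (xs ++ ys) ≡ sumℚ xs ⊕ sumℚ ys
sumℚ-++ []       ys = sym (+-identityˡ (sumℚ ys))
sumℚ-++ (x ∷ xs) ys = trans (cong (x ⊕_) (sumℚ-++ xs ys)) (sym (+-assoc x (sumℚ xs) (sumℚ ys)))

sumℚ-map-concatMap : ∀ {A B : Set} (h : B → ℚ) (g : A → List B) xs →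
  sumℚ (map h (concatMap g xs)) ≡ sumℚ (map (λ x → sumℚ (map h (g x))) xs)
sumℚ-map-concatMap h g []       = refl
sumℚ-map-concatMap h g (x ∷ xs) = begin
  sumℚ (map h (g x ++ concatMap g xs))                   ≡⟨ cong sumℚ (map-++ h (g x) (concatMap g xs)) ⟩
  sumℚ (map h (g x) ++ map h (concatMap g xs))           ≡⟨ sumℚ-++ (map h (g x)) (map h (concatMap g xs)) ⟩
  sumℚ (map h (g x)) ⊕ sumℚ (map h (concatMap g xs))     ≡⟨ cong (sumℚ (map h (g x)) ⊕_) (sumℚ-map-concatMap h g xs) ⟩
  sumℚ (map (λ y → sumℚ (map h (g y))) (x ∷ xs))         ∎

*-distribˡ-sumℚ : ∀ c xs → c * sumℚ xs ≡ sumℚ (map (c *_) xs)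
*-distribˡ-sumℚ c []       = *-zeroʳ c
*-distribˡ-sumℚ c (x ∷ xs) = trans (*-distribˡ-+ c x (sumℚ xs)) (cong (c * x ⊕_) (*-distribˡ-sumℚ c xs))

aCoef-zero : ∀ N → aCoef N 0 ≡ 1ℚ
aCoef-zero N = trans
  (/-cong {+ fact (2 ℕ.* N)} {{fact-nonZero (2 ℕ.* N ℕ.+ 0)}} {{fact-nonZero (2 ℕ.* N)}}
          refl (cong fact (ℕ.+-identityʳ (2 ℕ.* N))))
  (n/n≡1 (fact (2 ℕ.* N)) {{fact-nonZero (2 ℕ.* N)}})

recipRev≡applyUpTo : ∀ N n → recipRev N n ≡ applyUpTo (λ j → recipCoef N (n ∸ j)) (suc n)
recipRev≡applyUpTo N zero    = refl
recipRev≡applyUpTo N (suc n) = cong (recipCoef N (suc n) ∷_) (recipRev≡applyUpTo N n)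

recipCoef-rec : ∀ N n → recipCoef N n ≡ δ n - (fCoef N ⋆⁺ recipCoef N) n
recipCoef-rec N zero    = refl
recipCoef-rec N (suc n) = begin
  - sumℚ (zipWith _*_ (map (fCoef N ∘ suc) (upTo (suc n))) (recipRev N n))
    ≡⟨ cong (λ bs → - sumℚ (zipWith _*_ (map (fCoef N ∘ suc) (upTo (suc n))) bs)) (recipRev≡applyUpTo N n) ⟩
  - sumℚ (zipWith _*_ (map (fCoef N ∘ suc) (upTo (suc n))) (applyUpTo (λ j → recipCoef N (n ∸ j)) (suc n)))
    ≡⟨ cong -_ (sumℚ-zipWith-* (fCoef N ∘ suc) (λ j → j) (λ j → recipCoef N (n ∸ j)) (suc n)) ⟩
  - (fCoef N ⋆⁺ recipCoef N) (suc n)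
    ≡⟨ +-identityˡ _ ⟨
  δ (suc n) - (fCoef N ⋆⁺ recipCoef N) (suc n) ∎

term-∷ : ∀ N k i is → term N (suc k) (i ∷ is) ≡ aCoef N i * term N k is
term-∷ N k i is = /-homo-* (fact (2 ℕ.* N)) (fact (2 ℕ.* N) ℕ.^ k) (fact (2 ℕ.* N ℕ.+ 2 ℕ.* i)) (prodFact N is)
  {{fact-nonZero (2 ℕ.* N ℕ.+ 2 ℕ.* i)}} {{prodFact-nonZero N is}}

innerSum-zero : ∀ N s → innerSum N 0 s ≡ δ s
innerSum-zero N zero    = refl
innerSum-zero N (suc s) = refl

-- Splitting off the first entry i₁ of the tuple turns the sum over k+1 tuples into a Cauchy product.
innerSum-suc : ∀ N k s → innerSum N (suc k) s ≡ (aCoef N ⋆ innerSum N k) s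
innerSum-suc N k s = begin
  sumℚ (map (term N (suc k)) (concatMap (λ i → map (i ∷_) (tuples k (s ∸ i))) (upTo (suc s))))
    ≡⟨ sumℚ-map-concatMap (term N (suc k)) (λ i → map (i ∷_) (tuples k (s ∸ i))) (upTo (suc s)) ⟩
  sumℚ (map (λ i → sumℚ (map (term N (suc k)) (map (i ∷_) (tuples k (s ∸ i))))) (upTo (suc s)))
    ≡⟨ sumℚ-map-applyUpTo (λ i → sumℚ (map (term N (suc k)) (map (i ∷_) (tuples k (s ∸ i))))) (λ i → i) (suc s) ⟩
  ∑ℕ (suc s) (λ i → sumℚ (map (term N (suc k)) (map (i ∷_) (tuples k (s ∸ i)))))
    ≡⟨ ∑ℕ-cong (suc s) (λ i → first-entry i (tuples k (s ∸ i))) ⟩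
  (aCoef N ⋆ innerSum N k) s ∎
  where
  first-entry : ∀ i tss → sumℚ (map (term N (suc k)) (map (i ∷_) tss)) ≡ aCoef N i * sumℚ (map (term N k) tss)
  first-entry i tss = begin
    sumℚ (map (term N (suc k)) (map (i ∷_) tss))         ≡⟨ cong sumℚ (map-∘ tss) ⟨
    sumℚ (map (term N (suc k) ∘ (i ∷_)) tss)             ≡⟨ cong sumℚ (map-cong (term-∷ N k i) tss) ⟩
    sumℚ (map ((aCoef N i *_) ∘ term N k) tss)           ≡⟨ cong sumℚ (map-∘ tss) ⟩
    sumℚ (map (aCoef N i *_) (map (term N k) tss))       ≡⟨ *-distribˡ-sumℚ (aCoef N i) (map (term N k) tss) ⟨
    aCoef N i * sumℚ (map (term N k) tss)                ∎

innerSum≡aCoef^⋆ : ∀ N k s → innerSum N k s ≡ (aCoef N ^⋆ k) s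
innerSum≡aCoef^⋆ N zero    s = innerSum-zero N s
innerSum≡aCoef^⋆ N (suc k) s = trans (innerSum-suc N k s) (⋆-congʳ (aCoef N) (innerSum≡aCoef^⋆ N k) s)

fCoef^⋆-even : ∀ N k q → (fCoef N ^⋆ k) (q ℕ.* 2) ≡ innerSum N k q
fCoef^⋆-even N k q = begin
  (fCoef N ^⋆ k) (q ℕ.* 2)                ≡⟨ evenSeries-^⋆ (aCoef N) k (q ℕ.* 2) ⟩
  evenSeries (aCoef N ^⋆ k) (q ℕ.* 2)     ≡⟨ evenSeries-double (aCoef N ^⋆ k) q ⟩
  (aCoef N ^⋆ k) q                        ≡⟨ innerSum≡aCoef^⋆ N k q ⟨
  innerSum N k q                          ∎

proposition3 : (N n : ℕ) → 2 ≤ n → 2 ∣ n →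
    E N n ≡ ℕ→ℚ (fact n) * sumℚ (map (λ k → sign k * ℕ→ℚ ((n + 1) C (k + 1)) * innerSum N k (n / 2)) (map suc (upTo n)))
proposition3 N _ () (divides zero refl)
proposition3 N n 2≤n (divides (suc q) refl) = cong (ℕ→ℚ (fact n) *_) (begin
  recipCoef N n
    ≡⟨ binomialSum≡reciprocal (fCoef N) (aCoef-zero N) (recipCoef N) (recipCoef-rec N) n n ℕ.≤-refl ⟨
  sign 0 * ℕ→ℚ (suc n C 1) * 0ℚ ⊕ ∑ℕ n (λ k → sign (suc k) * ℕ→ℚ (suc n C suc (suc k)) * (fCoef N ^⋆ suc k) n)
    ≡⟨ trans (cong (_⊕ binomialTail) (*-zeroʳ (sign 0 * ℕ→ℚ (suc n C 1)))) (+-identityˡ binomialTail) ⟩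
  binomialTail
    ≡⟨ ∑ℕ-cong n (λ k → cong₂ (λ m r → sign (suc k) * ℕ→ℚ m * r)
         (cong₂ _C_ (ℕ.+-comm 1 n) (cong suc (ℕ.+-comm 1 k)))
         (trans (fCoef^⋆-even N (suc k) (suc q)) (cong (innerSum N (suc k)) (sym (m*n/n≡m (suc q) 2))))) ⟩
  ∑ℕ n (G ∘ suc)
    ≡⟨ sumℚ-map-applyUpTo (G ∘ suc) (λ k → k) n ⟨
  sumℚ (map (G ∘ suc) (upTo n))
    ≡⟨ cong sumℚ (map-∘ {g = G} {f = suc} (upTo n)) ⟩
  sumℚ (map G (map suc (upTo n))) ∎)
  where
  binomialTail : ℚ
  binomialTail = ∑ℕ n (λ k → sign (suc k) * ℕ→ℚ (suc n C suc (suc k)) * (fCoef N ^⋆ suc k) n)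

  G : ℕ → ℚ
  G k = sign k * ℕ→ℚ ((n + 1) C (k + 1)) * innerSum N k (n / 2)
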